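{- For every even integer $k$ and every integer $d\ge k$, every finite $d$-regular graph contains a spanning subgraph in which every vertex has degree either $k$ or $k-1$. -}

module Defs where

open import Data.Nat using (ℕ)
open import Data.Bool using (Bool; true; false; T)
open import Data.Fin using (Fin)
open import Data.List using (List; length; filterᵇ; allFin)
open import Relation.Binary.PropositionalEquality using (_≡_)

record Graph (n : ℕ) : Set where
  field
    adj   : Fin n → Fin n → Bool
    sym   : ∀ u v → adj u v ≡ adj v u
    irrefl : ∀ v → adj v v ≡ false

open Graph public

degree : ∀ {n} → Graph n → Fin n → ℕ
degree G v = length (filterᵇ (adj G v) (allFin _))

Regular : ∀ {n} → ℕ → Graph n → Set
Regular d G = ∀ v → degree G v ≡ d

SpanningSubgraph : ∀ {n} → Graph n → Graph n → Set
SpanningSubgraph H G = ∀ u v → T (adj H u v) → T (adj G u v)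

{-# OPTIONS --safe #-}
-- Petersen's method. If d is odd then n is even (handshake lemma), and adding the perfect
-- matching i ↔ n ∸ 1 ∸ i makes the graph 2r-regular; if d = 2r nothing is added. A
-- 2r-regular multigraph has an orientation in which every in- and out-degree is r.
-- Splitting every vertex into an out-copy and an in-copy turns it into an r-regular
-- bipartite multigraph, which has an m-factor for every m ≤ r, where k = 2m. In the
-- multigraph this factor gives every vertex degree 2m, and deleting the added matching
-- lowers that by at most one.
-- Both the balanced orientation and the bipartite factor come from Hakimi's theorem: a
-- multigraph has an orientation with out-degrees at least lo if every vertex set S has
-- Σ_{v ∈ S} lo v at most the number of edges meeting S. Induction on the number of edges:
-- remove an edge ab; if the condition fails both for lo lowered at a and for lo lowered at
-- b, the two violating sets S and T contradict modularity of the weights and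
-- submodularity of the edge counts, applied to S ∪ T and S ∩ T.
module Submission where

open import Data.Bool using (Bool; true; false; _∧_; _∨_)
open import Data.Bool.Properties using (∧-zeroʳ)
open import Data.Empty using (⊥; ⊥-elim)
open import Data.Fin using (Fin; zero; suc; toℕ; opposite; _≟_; _↑ˡ_; _↑ʳ_; splitAt)
open import Data.Fin.Properties as Fin using (splitAt-↑ˡ; splitAt-↑ʳ; opposite-prop; opposite-involutive; toℕ<n)
open import Data.Fin.Subset using (Subset; _∪_; _∩_; ⊤)
open import Data.Fin.Subset.Properties using (anySubset?)
import Data.List as List
open import Data.Nat.Base
open import Data.Nat.Divisibility using (_∣_; divides; ∣1⇒≡1; ∣m+n∣m⇒∣n; ∣m∣n⇒∣m+n; ∣-refl)
open import Data.Nat.Primality using (euclidsLemma; prime[2])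
open import Data.Nat.Properties hiding (_≟_)
open import Data.Nat.Solver using (module +-*-Solver)
open import Data.Product using (Σ; ∃; ∃-syntax; _×_; _,_; proj₁; proj₂)
open import Data.Sum using (_⊎_; inj₁; inj₂)
open import Data.Unit using (tt)
open import Data.Vec using (lookup; tabulate)
open import Data.Vec.Properties using (lookup-zipWith; lookup-replicate; lookup∘tabulate)
open import Function using (_∘_)
open import Relation.Binary.Definitions using (tri<; tri≈; tri>)
open import Relation.Binary.PropositionalEquality
open import Relation.Nullary using (¬_; does; yes; no)
open import Relation.Nullary.Decidable using (True; toWitness; dec-true; dec-false)

open import Algebra.Properties.CommutativeSemigroup +-commutativeSemigroup using () renaming (interchange to +-interchange)
open import Algebra.Properties.Semiring.Sum +-*-semiring
  using (sum; sum-cong-≗; ∑-distrib-+; ∑-comm; *-distribˡ-sum; *-distribʳ-sum)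
open +-*-Solver using (solve; _:+_; _:*_; con; _:=_)

open import Defs hiding (sym)

-- Arithmetic and finite sums

m+m≡m*2 : ∀ m → m + m ≡ m * 2
m+m≡m*2 m = trans (cong (m +_) (sym (+-identityʳ m))) (*-comm 2 m)

≤-convex : ∀ {m r a b t} → m ≤ r → r * a ≤ t → r * b ≤ t → m * a + (r ∸ m) * b ≤ t
≤-convex {m} {r} {a} {b} m≤r ra≤t rb≤t with ≤-total a b
... | inj₁ a≤b = ≤-trans (+-monoˡ-≤ _ (*-monoʳ-≤ m a≤b))
                         (≤-trans (≤-reflexive (trans (sym (*-distribʳ-+ b m (r ∸ m))) (cong (_* b) (m+[n∸m]≡n m≤r)))) rb≤t)
... | inj₂ b≤a = ≤-trans (+-monoʳ-≤ (m * a) (*-monoʳ-≤ (r ∸ m) b≤a))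
                         (≤-trans (≤-reflexive (trans (sym (*-distribʳ-+ a m (r ∸ m))) (cong (_* a) (m+[n∸m]≡n m≤r)))) ra≤t)

≤-≤-suc⇒≡⊎suc≡ : ∀ {a k} → a ≤ k → k ≤ suc a → a ≡ k ⊎ suc a ≡ k
≤-≤-suc⇒≡⊎suc≡ a≤k k≤1+a with m≤n⇒m<n∨m≡n a≤k
... | inj₁ a<k = inj₂ (≤-antisym a<k k≤1+a)
... | inj₂ a≡k = inj₁ a≡k

≤-decide : ∀ {m n} {m≤?n : True (m ≤? n)} → m ≤ n
≤-decide {m≤?n = m≤n} = toWitness m≤n

¬2∣1 : ¬ 2 ∣ 1
¬2∣1 2∣1 with () ← ∣1⇒≡1 2∣1

even-or-odd : ∀ d → 2 ∣ d ⊎ 2 ∣ suc d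
even-or-odd zero = inj₁ (divides 0 refl)
even-or-odd (suc d) with even-or-odd d
... | inj₁ 2∣d   = inj₂ (∣m∣n⇒∣m+n ∣-refl 2∣d)
... | inj₂ 2∣1+d = inj₁ 2∣1+d

⟦_⟧ : Bool → ℕ
⟦ true ⟧ = 1
⟦ false ⟧ = 0

⟦⟧≤1 : ∀ b → ⟦ b ⟧ ≤ 1
⟦⟧≤1 true = s≤s z≤n
⟦⟧≤1 false = z≤n

⟦⟧-mono-∨ˡ : ∀ s t → ⟦ s ⟧ ≤ ⟦ s ∨ t ⟧
⟦⟧-mono-∨ˡ true  t = ≤-refl
⟦⟧-mono-∨ˡ false t = z≤n

⟦⟧-mono-∨ʳ : ∀ s t → ⟦ t ⟧ ≤ ⟦ s ∨ t ⟧
⟦⟧-mono-∨ʳ true  t = ⟦⟧≤1 t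
⟦⟧-mono-∨ʳ false t = ≤-refl

δ : ∀ {N} → Fin N → Fin N → ℕ
δ a i = ⟦ does (i ≟ a) ⟧

∑-const : ∀ N m → sum {N} (λ _ → m) ≡ N * m
∑-const zero m = refl
∑-const (suc N) m = cong (m +_) (∑-const N m)

∑-zero : ∀ {N} {f : Fin N → ℕ} → (∀ i → f i ≡ 0) → sum f ≡ 0
∑-zero {N} f≗0 = trans (sum-cong-≗ f≗0) (trans (∑-const N 0) (*-zeroʳ N))

∑-single : ∀ {N} (f : Fin N → ℕ) (a : Fin N) → (∀ i → ¬ i ≡ a → f i ≡ 0) → sum f ≡ f a
∑-single {suc N} f zero f≗0 = trans (cong (f zero +_) (∑-zero (λ i → f≗0 (suc i) λ ()))) (+-identityʳ _)
∑-single {suc N} f (suc a) f≗0 = trans (cong (_+ sum (f ∘ suc)) (f≗0 zero λ ()))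
  (∑-single (f ∘ suc) a (λ i i≢a → f≗0 (suc i) (i≢a ∘ Fin.suc-injective)))

∑-δ* : ∀ {N} (a : Fin N) (g : Fin N → ℕ) → sum (λ i → δ a i * g i) ≡ g a
∑-δ* a g = trans (∑-single _ a off-a) (trans (cong (λ b → ⟦ b ⟧ * g a) (dec-true (a ≟ a) refl)) (+-identityʳ (g a)))
  where
  off-a : ∀ i → ¬ i ≡ a → δ a i * g i ≡ 0
  off-a i i≢a with i ≟ a
  ... | yes i≡a = ⊥-elim (i≢a i≡a)
  ... | no _ = refl

∑-↑ : ∀ m {n} (f : Fin (m + n) → ℕ) → sum f ≡ sum (λ i → f (i ↑ˡ n)) + sum (λ j → f (m ↑ʳ j))
∑-↑ zero f = refl
∑-↑ (suc m) f = trans (cong (f zero +_) (∑-↑ m (f ∘ suc))) (sym (+-assoc (f zero) _ _))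

∑-∸ : ∀ {N} (f g : Fin N → ℕ) → (∀ i → g i ≤ f i) → sum (λ i → f i ∸ g i) ≡ sum f ∸ sum g
∑-∸ {N} f g g≤f = begin
  sum (λ i → f i ∸ g i)                      ≡⟨ m+n∸n≡m _ (sum g) ⟨
  sum (λ i → f i ∸ g i) + sum g ∸ sum g      ≡⟨ cong (_∸ sum g) (∑-distrib-+ {N} (λ i → f i ∸ g i) g) ⟨
  sum (λ i → f i ∸ g i + g i) ∸ sum g        ≡⟨ cong (_∸ sum g) (sum-cong-≗ {N} λ i → m∸n+n≡m (g≤f i)) ⟩
  sum f ∸ sum g                              ∎
  where open ≡-Reasoning

∑-mono-≤ : ∀ {N} {f g : Fin N → ℕ} → (∀ i → f i ≤ g i) → sum f ≤ sum g
∑-mono-≤ {zero} f≤g = z≤n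
∑-mono-≤ {suc N} f≤g = +-mono-≤ (f≤g zero) (∑-mono-≤ (f≤g ∘ suc))

term≤∑ : ∀ {N} (f : Fin N → ℕ) (a : Fin N) → f a ≤ sum f
term≤∑ f zero = m≤m+n _ _
term≤∑ f (suc a) = ≤-trans (term≤∑ (f ∘ suc) a) (m≤n+m _ _)

∑>0⇒∃>0 : ∀ {N} (f : Fin N → ℕ) → 0 < sum f → ∃ λ i → 0 < f i
∑>0⇒∃>0 {suc N} f ∑f>0 with f zero in eq
... | suc _ = zero , subst (0 <_) (sym eq) (s≤s z≤n)
... | zero with ∑>0⇒∃>0 (f ∘ suc) ∑f>0
...   | i , fi>0 = suc i , fi>0

∑-squeeze : ∀ {N} {f g : Fin N → ℕ} → (∀ i → f i ≤ g i) → sum g ≤ sum f → ∀ i → f i ≡ g i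
∑-squeeze f≤g ∑g≤∑f zero = ≤-antisym (f≤g zero)
  (+-cancelʳ-≤ _ _ _ (≤-trans ∑g≤∑f (+-monoʳ-≤ _ (∑-mono-≤ (f≤g ∘ suc)))))
∑-squeeze f≤g ∑g≤∑f (suc i) = ∑-squeeze (f≤g ∘ suc)
  (+-cancelˡ-≤ _ _ _ (≤-trans ∑g≤∑f (+-monoˡ-≤ _ (f≤g zero)))) i

-- Hakimi's orientation theorem

-- A multigraph on Fin N has c u w edges joining u and w listed under the pair (u , w).
-- An orientation p ⊑ c directs p u w of them from u to w and the other c u w ∸ p u w
-- from w to u.
Arcs : ℕ → Set
Arcs N = Fin N → Fin N → ℕ

module _ {N : ℕ} where

  _⊑_ : Arcs N → Arcs N → Set
  p ⊑ c = ∀ u w → p u w ≤ c u w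

  total : Arcs N → ℕ
  total c = sum λ u → sum λ w → c u w

  outdegree : Arcs N → Arcs N → Fin N → ℕ
  outdegree c p v = sum (p v) + sum (λ u → c u v ∸ p u v)

  Orientation : Arcs N → (Fin N → ℕ) → Set
  Orientation c lo = ∃[ p ] p ⊑ c × (∀ v → lo v ≤ outdegree c p v)

  weight : (Fin N → ℕ) → Subset N → ℕ
  weight lo S = sum λ v → ⟦ lookup S v ⟧ * lo v

  touching : Arcs N → Subset N → ℕ
  touching c S = sum λ u → sum λ w → c u w * ⟦ lookup S u ∨ lookup S w ⟧

  HakimiCondition : Arcs N → (Fin N → ℕ) → Set
  HakimiCondition c lo = ∀ S → weight lo S ≤ touching c S

  hakimi-or-violation : ∀ c lo → HakimiCondition c lo ⊎ ∃[ S ] touching c S < weight lo S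
  hakimi-or-violation c lo with anySubset? (λ S → touching c S <? weight lo S)
  ... | yes violation = inj₂ violation
  ... | no ¬violation = inj₁ λ S → ≮⇒≥ (¬violation ∘ (S ,_))

  weight-⊤ : ∀ lo → weight lo ⊤ ≡ sum lo
  weight-⊤ lo = sum-cong-≗ λ v → trans (cong (λ b → ⟦ b ⟧ * lo v) (lookup-replicate v true)) (+-identityʳ (lo v))

  touching≤total : ∀ c S → touching c S ≤ total c
  touching≤total c S = ∑-mono-≤ λ u → ∑-mono-≤ λ w →
    ≤-trans (*-monoʳ-≤ (c u w) (⟦⟧≤1 _)) (≤-reflexive (*-identityʳ _))

  weight-modular : ∀ lo S T → weight lo (S ∪ T) + weight lo (S ∩ T) ≡ weight lo S + weight lo T
  weight-modular lo S T = begin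
    weight lo (S ∪ T) + weight lo (S ∩ T)
      ≡⟨ ∑-distrib-+ {N} _ _ ⟨
    sum (λ v → ⟦ lookup (S ∪ T) v ⟧ * lo v + ⟦ lookup (S ∩ T) v ⟧ * lo v)
      ≡⟨ sum-cong-≗ (λ v → trans
           (cong₂ (λ x y → ⟦ x ⟧ * lo v + ⟦ y ⟧ * lo v) (lookup-zipWith _∨_ v S T) (lookup-zipWith _∧_ v S T))
           (pointwise (lookup S v) (lookup T v) (lo v))) ⟩
    sum (λ v → ⟦ lookup S v ⟧ * lo v + ⟦ lookup T v ⟧ * lo v)
      ≡⟨ ∑-distrib-+ {N} _ _ ⟩
    weight lo S + weight lo T ∎
    where
    open ≡-Reasoning
    pointwise : ∀ s t l → ⟦ s ∨ t ⟧ * l + ⟦ s ∧ t ⟧ * l ≡ ⟦ s ⟧ * l + ⟦ t ⟧ * l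
    pointwise true  true  l = refl
    pointwise true  false l = refl
    pointwise false true  l = +-comm (l + 0) 0
    pointwise false false l = refl

  touching-submodular : ∀ c S T → touching c (S ∪ T) + touching c (S ∩ T) ≤ touching c S + touching c T
  touching-submodular c S T = begin
    touching c (S ∪ T) + touching c (S ∩ T)
      ≡⟨ double-sum-+ _ _ ⟨
    sum (λ u → sum λ w → c u w * ⟦ lookup (S ∪ T) u ∨ lookup (S ∪ T) w ⟧
                         + c u w * ⟦ lookup (S ∩ T) u ∨ lookup (S ∩ T) w ⟧)
      ≤⟨ ∑-mono-≤ (λ u → ∑-mono-≤ λ w → pointwise u w) ⟩
    sum (λ u → sum λ w → c u w * ⟦ lookup S u ∨ lookup S w ⟧ + c u w * ⟦ lookup T u ∨ lookup T w ⟧)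
      ≡⟨ double-sum-+ _ _ ⟩
    touching c S + touching c T ∎
    where
    open ≤-Reasoning
    double-sum-+ : ∀ (f g : Arcs N) → sum (λ u → sum λ w → f u w + g u w) ≡ sum (λ u → sum (f u)) + sum (λ u → sum (g u))
    double-sum-+ f g = trans (sum-cong-≗ λ u → ∑-distrib-+ (f u) (g u)) (∑-distrib-+ {N} _ _)
    boolean : ∀ su sw tu tw → ⟦ (su ∨ tu) ∨ (sw ∨ tw) ⟧ + ⟦ (su ∧ tu) ∨ (sw ∧ tw) ⟧ ≤ ⟦ su ∨ sw ⟧ + ⟦ tu ∨ tw ⟧
    boolean true  true  true  true  = ≤-decide
    boolean true  true  true  false = ≤-decide
    boolean true  true  false true  = ≤-decide
    boolean true  true  false false = ≤-decide
    boolean true  false true  true  = ≤-decide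
    boolean true  false true  false = ≤-decide
    boolean true  false false true  = ≤-decide
    boolean true  false false false = ≤-decide
    boolean false true  true  true  = ≤-decide
    boolean false true  true  false = ≤-decide
    boolean false true  false true  = ≤-decide
    boolean false true  false false = ≤-decide
    boolean false false true  true  = ≤-decide
    boolean false false true  false = ≤-decide
    boolean false false false true  = ≤-decide
    boolean false false false false = ≤-decide
    pointwise : ∀ u w → c u w * ⟦ lookup (S ∪ T) u ∨ lookup (S ∪ T) w ⟧
                        + c u w * ⟦ lookup (S ∩ T) u ∨ lookup (S ∩ T) w ⟧
                      ≤ c u w * ⟦ lookup S u ∨ lookup S w ⟧ + c u w * ⟦ lookup T u ∨ lookup T w ⟧
    pointwise u w
      rewrite lookup-zipWith _∨_ u S T | lookup-zipWith _∧_ u S T | lookup-zipWith _∨_ w S T | lookup-zipWith _∧_ w S T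
      = subst₂ _≤_ (*-distribˡ-+ (c u w) _ _) (*-distribˡ-+ (c u w) _ _)
          (*-monoʳ-≤ (c u w) (boolean (lookup S u) (lookup S w) (lookup T u) (lookup T w)))

  support : (Fin N → ℕ) → Subset N
  support lo = tabulate λ v → 0 <ᵇ lo v

  lookup-∩-support : ∀ lo S v → lookup (S ∩ support lo) v ≡ lookup S v ∧ (0 <ᵇ lo v)
  lookup-∩-support lo S v = trans (lookup-zipWith _∧_ v S (support lo)) (cong (lookup S v ∧_) (lookup∘tabulate _ v))

  ∈-∩-support⇒positive : ∀ lo S v → lookup (S ∩ support lo) v ≡ true → 0 < lo v
  ∈-∩-support⇒positive lo S v v∈S′ with lo v | lookup-∩-support lo S v
  ... | suc _ | _ = s≤s z≤n
  ... | zero  | v∉S′ rewrite ∧-zeroʳ (lookup S v) with () ← trans (sym v∈S′) v∉S′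

  weight-∩-support : ∀ lo (x : Fin N → ℕ) S → weight (λ v → lo v ∸ x v) (S ∩ support lo) ≡ weight (λ v → lo v ∸ x v) S
  weight-∩-support lo x S = sum-cong-≗ {N} λ v →
    trans (cong (λ b → ⟦ b ⟧ * (lo v ∸ x v)) (lookup-∩-support lo S v)) (pointwise (lookup S v) (lo v) (x v))
    where
    pointwise : ∀ s l y → ⟦ s ∧ (0 <ᵇ l) ⟧ * (l ∸ y) ≡ ⟦ s ⟧ * (l ∸ y)
    pointwise s     zero    y rewrite 0∸n≡0 y | *-zeroʳ ⟦ s ∧ false ⟧ = sym (*-zeroʳ ⟦ s ⟧)
    pointwise true  (suc l) y = refl
    pointwise false (suc l) y = refl

  touching-∩ : ∀ c S T → touching c (S ∩ T) ≤ touching c S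
  touching-∩ c S T = ∑-mono-≤ λ u → ∑-mono-≤ λ w → *-monoʳ-≤ (c u w)
    (subst₂ (λ x y → ⟦ x ∨ y ⟧ ≤ ⟦ lookup S u ∨ lookup S w ⟧)
      (sym (lookup-zipWith _∧_ u S T)) (sym (lookup-zipWith _∧_ w S T))
      (pointwise (lookup S u) (lookup T u) (lookup S w) (lookup T w)))
    where
    pointwise : ∀ su tu sw tw → ⟦ (su ∧ tu) ∨ (sw ∧ tw) ⟧ ≤ ⟦ su ∨ sw ⟧
    pointwise true  true  sw tw = ≤-refl
    pointwise true  false sw tw = ⟦⟧≤1 _
    pointwise false tu true  tw = ⟦⟧≤1 _
    pointwise false tu false tw = z≤n

  violation-∩-support : ∀ c lo (x : Fin N → ℕ) S → touching c S < weight (λ v → lo v ∸ x v) S →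
                        touching c (S ∩ support lo) < weight (λ v → lo v ∸ x v) (S ∩ support lo)
  violation-∩-support c lo x S violation =
    ≤-<-trans (touching-∩ c S _) (<-≤-trans violation (≤-reflexive (sym (weight-∩-support lo x S))))

  weight-∸δ : ∀ lo a S → (∀ v → lookup S v ≡ true → 0 < lo v) →
              weight lo S ≡ weight (λ v → lo v ∸ δ a v) S + ⟦ lookup S a ⟧
  weight-∸δ lo a S S-positive = begin
    weight lo S
      ≡⟨ sum-cong-≗ {N} pointwise ⟩
    sum (λ v → ⟦ lookup S v ⟧ * (lo v ∸ δ a v) + δ a v * ⟦ lookup S v ⟧)
      ≡⟨ ∑-distrib-+ {N} _ _ ⟩
    weight (λ v → lo v ∸ δ a v) S + sum (λ v → δ a v * ⟦ lookup S v ⟧)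
      ≡⟨ cong (weight (λ v → lo v ∸ δ a v) S +_) (∑-δ* a _) ⟩
    weight (λ v → lo v ∸ δ a v) S + ⟦ lookup S a ⟧ ∎
    where
    open ≡-Reasoning
    pointwise : ∀ v → ⟦ lookup S v ⟧ * lo v ≡ ⟦ lookup S v ⟧ * (lo v ∸ δ a v) + δ a v * ⟦ lookup S v ⟧
    pointwise v with lookup S v in v∈S
    ... | false = sym (*-zeroʳ (δ a v))
    ... | true  = begin
      lo v + 0                           ≡⟨ +-identityʳ (lo v) ⟩
      lo v                               ≡⟨ m∸n+n≡m (≤-trans (⟦⟧≤1 (does (v ≟ a))) (S-positive v v∈S)) ⟨
      (lo v ∸ δ a v) + δ a v             ≡⟨ cong₂ _+_ (+-identityʳ (lo v ∸ δ a v)) (*-identityʳ (δ a v)) ⟨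
      (lo v ∸ δ a v + 0) + δ a v * 1     ∎

  total>0⇒arc : ∀ c → 0 < total c → ∃[ a ] ∃[ b ] 0 < c a b
  total>0⇒arc c total>0 with ∑>0⇒∃>0 (λ u → sum (c u)) total>0
  ... | a , ca>0 with ∑>0⇒∃>0 (c a) ca>0
  ...   | b , cab>0 = a , b , cab>0

  -- Intersecting with the support keeps S violating, and there the weight of lo ∸ δ a
  -- really is one less at a (truncated subtraction loses nothing where lo a = 0).
  restricted-violation : ∀ c lo a S → touching c S < weight (λ v → lo v ∸ δ a v) S →
                         suc (touching c (S ∩ support lo)) + ⟦ lookup (S ∩ support lo) a ⟧ ≤ weight lo (S ∩ support lo)
  restricted-violation c lo a S violation = begin
    suc (touching c S′) + ⟦ lookup S′ a ⟧             ≤⟨ +-monoˡ-≤ _ (violation-∩-support c lo (δ a) S violation) ⟩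
    weight (λ v → lo v ∸ δ a v) S′ + ⟦ lookup S′ a ⟧  ≡⟨ weight-∸δ lo a S′ (∈-∩-support⇒positive lo S) ⟨
    weight lo S′                                      ∎
    where
    open ≤-Reasoning
    S′ = S ∩ support lo

  arc : Fin N → Fin N → Arcs N
  arc a b u w = δ a u * δ b w

  ∑∑-arc* : ∀ a b (g : Arcs N) → sum (λ u → sum λ w → arc a b u w * g u w) ≡ g a b
  ∑∑-arc* a b g = begin
    sum (λ u → sum λ w → δ a u * δ b w * g u w)
      ≡⟨ sum-cong-≗ {N} (λ u → trans (sum-cong-≗ {N} λ w → *-assoc (δ a u) (δ b w) (g u w))
                                      (sym (*-distribˡ-sum (δ a u) (λ w → δ b w * g u w)))) ⟩
    sum (λ u → δ a u * sum λ w → δ b w * g u w)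
      ≡⟨ ∑-δ* a _ ⟩
    sum (λ w → δ b w * g a w)
      ≡⟨ ∑-δ* b _ ⟩
    g a b ∎
    where open ≡-Reasoning

  arc⊑ : ∀ c {a b} → 0 < c a b → arc a b ⊑ c
  arc⊑ c {a} {b} cab>0 u w with u ≟ a | w ≟ b
  ... | yes refl | yes refl = cab>0
  ... | yes _    | no _     = z≤n
  ... | no _     | _        = z≤n

  crossing-bound : ∀ sa sb ta tb → ⟦ (sa ∨ ta) ∨ (sb ∨ tb) ⟧ + ⟦ (sa ∧ ta) ∨ (sb ∧ tb) ⟧ < 2 + ⟦ sa ⟧ + ⟦ tb ⟧
  crossing-bound true  true  true  true  = ≤-decide
  crossing-bound true  true  true  false = ≤-decide
  crossing-bound true  true  false true  = ≤-decide
  crossing-bound true  true  false false = ≤-decide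
  crossing-bound true  false true  true  = ≤-decide
  crossing-bound true  false true  false = ≤-decide
  crossing-bound true  false false true  = ≤-decide
  crossing-bound true  false false false = ≤-decide
  crossing-bound false true  true  true  = ≤-decide
  crossing-bound false true  true  false = ≤-decide
  crossing-bound false true  false true  = ≤-decide
  crossing-bound false true  false false = ≤-decide
  crossing-bound false false true  true  = ≤-decide
  crossing-bound false false true  false = ≤-decide
  crossing-bound false false false true  = ≤-decide
  crossing-bound false false false false = ≤-decide

  module RemoveArc (c : Arcs N) {a b : Fin N} (cab>0 : 0 < c a b) where

    c⁻ : Arcs N
    c⁻ u w = c u w ∸ arc a b u w

    split : ∀ u w → c u w ≡ c⁻ u w + arc a b u w
    split u w = sym (m∸n+n≡m (arc⊑ c cab>0 u w))

    ∑∑-split : ∀ (g : Arcs N) → sum (λ u → sum λ w → c u w * g u w) ≡ sum (λ u → sum λ w → c⁻ u w * g u w) + g a b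
    ∑∑-split g = begin
      sum (λ u → sum λ w → c u w * g u w)
        ≡⟨ sum-cong-≗ {N} (λ u → trans (sum-cong-≗ {N} λ w → trans (cong (_* g u w) (split u w))
                                                                     (*-distribʳ-+ (g u w) (c⁻ u w) (arc a b u w)))
                                        (∑-distrib-+ {N} _ _)) ⟩
      sum (λ u → sum (λ w → c⁻ u w * g u w) + sum (λ w → arc a b u w * g u w))
        ≡⟨ ∑-distrib-+ {N} _ _ ⟩
      sum (λ u → sum λ w → c⁻ u w * g u w) + sum (λ u → sum λ w → arc a b u w * g u w)
        ≡⟨ cong (sum (λ u → sum λ w → c⁻ u w * g u w) +_) (∑∑-arc* a b g) ⟩
      sum (λ u → sum λ w → c⁻ u w * g u w) + g a b ∎
      where open ≡-Reasoning

    total-c⁻ : total c ≡ suc (total c⁻)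
    total-c⁻ = begin
      total c                                    ≡⟨ ∑∑-*1 c ⟨
      sum (λ u → sum λ w → c u w * 1)            ≡⟨ ∑∑-split (λ _ _ → 1) ⟩
      sum (λ u → sum λ w → c⁻ u w * 1) + 1       ≡⟨ cong (_+ 1) (∑∑-*1 c⁻) ⟩
      total c⁻ + 1                               ≡⟨ +-comm (total c⁻) 1 ⟩
      suc (total c⁻)                             ∎
      where
      open ≡-Reasoning
      ∑∑-*1 : ∀ (d : Arcs N) → sum (λ u → sum λ w → d u w * 1) ≡ total d
      ∑∑-*1 d = sum-cong-≗ {N} λ u → sum-cong-≗ {N} λ w → *-identityʳ (d u w)

    touching-c⁻ : ∀ S → touching c S ≡ touching c⁻ S + ⟦ lookup S a ∨ lookup S b ⟧
    touching-c⁻ S = ∑∑-split λ u w → ⟦ lookup S u ∨ lookup S w ⟧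

    outdegree-forward : ∀ p v → outdegree c (λ u w → p u w + arc a b u w) v ≡ δ a v + outdegree c⁻ p v
    outdegree-forward p v = begin
      sum (λ w → p v w + arc a b v w) + sum (λ u → c u v ∸ (p u v + arc a b u v))
        ≡⟨ cong₂ _+_ (∑-distrib-+ {N} (p v) (arc a b v)) (sum-cong-≗ {N} λ u → cancel u) ⟩
      (sum (p v) + sum (arc a b v)) + sum (λ u → c⁻ u v ∸ p u v)
        ≡⟨ cong (λ x → (sum (p v) + x) + sum (λ u → c⁻ u v ∸ p u v)) row-arc ⟩
      (sum (p v) + δ a v) + sum (λ u → c⁻ u v ∸ p u v)
        ≡⟨ cong (_+ sum (λ u → c⁻ u v ∸ p u v)) (+-comm (sum (p v)) (δ a v)) ⟩
      (δ a v + sum (p v)) + sum (λ u → c⁻ u v ∸ p u v)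
        ≡⟨ +-assoc (δ a v) (sum (p v)) _ ⟩
      δ a v + outdegree c⁻ p v ∎
      where
      open ≡-Reasoning
      cancel : ∀ u → c u v ∸ (p u v + arc a b u v) ≡ c⁻ u v ∸ p u v
      cancel u = begin
        c u v ∸ (p u v + arc a b u v)                 ≡⟨ cong (_∸ (p u v + arc a b u v)) (split u v) ⟩
        (c⁻ u v + arc a b u v) ∸ (p u v + arc a b u v) ≡⟨ cong₂ _∸_ (+-comm (c⁻ u v) _) (+-comm (p u v) _) ⟩
        (arc a b u v + c⁻ u v) ∸ (arc a b u v + p u v) ≡⟨ [m+n]∸[m+o]≡n∸o (arc a b u v) (c⁻ u v) (p u v) ⟩
        c⁻ u v ∸ p u v                                ∎
      row-arc : sum (arc a b v) ≡ δ a v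
      row-arc = trans (sum-cong-≗ {N} λ w → *-comm (δ a v) (δ b w)) (∑-δ* b (λ _ → δ a v))

    outdegree-backward : ∀ p → p ⊑ c⁻ → ∀ v → outdegree c p v ≡ δ b v + outdegree c⁻ p v
    outdegree-backward p p⊑c⁻ v = begin
      sum (p v) + sum (λ u → c u v ∸ p u v)
        ≡⟨ cong (sum (p v) +_) (sum-cong-≗ {N} λ u → trans (cong (_∸ p u v) (split u v)) (+-∸-comm (arc a b u v) (p⊑c⁻ u v))) ⟩
      sum (p v) + sum (λ u → (c⁻ u v ∸ p u v) + arc a b u v)
        ≡⟨ cong (sum (p v) +_) (∑-distrib-+ {N} (λ u → c⁻ u v ∸ p u v) (λ u → arc a b u v)) ⟩
      sum (p v) + (sum (λ u → c⁻ u v ∸ p u v) + sum (λ u → arc a b u v))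
        ≡⟨ cong (λ x → sum (p v) + (sum (λ u → c⁻ u v ∸ p u v) + x)) (∑-δ* a (λ _ → δ b v)) ⟩
      sum (p v) + (sum (λ u → c⁻ u v ∸ p u v) + δ b v)
        ≡⟨ +-assoc (sum (p v)) _ (δ b v) ⟨
      outdegree c⁻ p v + δ b v
        ≡⟨ +-comm (outdegree c⁻ p v) (δ b v) ⟩
      δ b v + outdegree c⁻ p v ∎
      where open ≡-Reasoning

    orient-forward : ∀ lo → Orientation c⁻ (λ v → lo v ∸ δ a v) → Orientation c lo
    orient-forward lo (p , p⊑c⁻ , out≥) = (λ u w → p u w + arc a b u w) , p⁺⊑c , λ v → begin
      lo v                         ≤⟨ m≤n+m∸n (lo v) (δ a v) ⟩
      δ a v + (lo v ∸ δ a v)       ≤⟨ +-monoʳ-≤ (δ a v) (out≥ v) ⟩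
      δ a v + outdegree c⁻ p v     ≡⟨ outdegree-forward p v ⟨
      outdegree c (λ u w → p u w + arc a b u w) v ∎
      where
      open ≤-Reasoning
      p⁺⊑c : (λ u w → p u w + arc a b u w) ⊑ c
      p⁺⊑c u w = ≤-trans (+-monoˡ-≤ (arc a b u w) (p⊑c⁻ u w)) (≤-reflexive (sym (split u w)))

    orient-backward : ∀ lo → Orientation c⁻ (λ v → lo v ∸ δ b v) → Orientation c lo
    orient-backward lo (p , p⊑c⁻ , out≥) = p , (λ u w → ≤-trans (p⊑c⁻ u w) (m∸n≤m (c u w) (arc a b u w))) , λ v → begin
      lo v                         ≤⟨ m≤n+m∸n (lo v) (δ b v) ⟩
      δ b v + (lo v ∸ δ b v)       ≤⟨ +-monoʳ-≤ (δ b v) (out≥ v) ⟩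
      δ b v + outdegree c⁻ p v     ≡⟨ outdegree-backward p p⊑c⁻ v ⟨
      outdegree c p v ∎
      where open ≤-Reasoning

    -- Adding the two violations and uncrossing them to S′ ∪ T′ and S′ ∩ T′ leaves a
    -- surplus of 2 + [a ∈ S′] + [b ∈ T′], which the removed edge ab cannot cover.
    no-double-violation : ∀ lo S T → HakimiCondition c lo →
                          touching c⁻ S < weight (λ v → lo v ∸ δ a v) S →
                          touching c⁻ T < weight (λ v → lo v ∸ δ b v) T → ⊥
    no-double-violation lo S T hakimi S-violates T-violates =
      <⇒≱ (crossing-bound (lookup S′ a) (lookup S′ b) (lookup T′ a) (lookup T′ b))
          (subst₂ (λ x y → 2 + ⟦ lookup S′ a ⟧ + ⟦ lookup T′ b ⟧ ≤ ⟦ x ⟧ + ⟦ y ⟧)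
            (cong₂ _∨_ (lookup-zipWith _∨_ a S′ T′) (lookup-zipWith _∨_ b S′ T′))
            (cong₂ _∨_ (lookup-zipWith _∧_ a S′ T′) (lookup-zipWith _∧_ b S′ T′))
            (+-cancelʳ-≤ (touching c⁻ S′ + touching c⁻ T′) _ _ counting))
      where
      S′ T′ : Subset N
      S′ = S ∩ support lo
      T′ = T ∩ support lo
      [_∋a∨b] : Subset N → ℕ
      [ X ∋a∨b] = ⟦ lookup X a ∨ lookup X b ⟧
      hakimi⁻ : ∀ X → weight lo X ≤ touching c⁻ X + [ X ∋a∨b]
      hakimi⁻ X = ≤-trans (hakimi X) (≤-reflexive (touching-c⁻ X))
      counting : (2 + ⟦ lookup S′ a ⟧ + ⟦ lookup T′ b ⟧) + (touching c⁻ S′ + touching c⁻ T′)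
                 ≤ ([ S′ ∪ T′ ∋a∨b] + [ S′ ∩ T′ ∋a∨b]) + (touching c⁻ S′ + touching c⁻ T′)
      counting = begin
        (2 + ⟦ lookup S′ a ⟧ + ⟦ lookup T′ b ⟧) + (touching c⁻ S′ + touching c⁻ T′)
          ≡⟨ solve 4 (λ x y s t → (con 2 :+ x :+ y) :+ (s :+ t) := (con 1 :+ s :+ x) :+ (con 1 :+ t :+ y))
                     refl ⟦ lookup S′ a ⟧ ⟦ lookup T′ b ⟧ (touching c⁻ S′) (touching c⁻ T′) ⟩
        (suc (touching c⁻ S′) + ⟦ lookup S′ a ⟧) + (suc (touching c⁻ T′) + ⟦ lookup T′ b ⟧)
          ≤⟨ +-mono-≤ (restricted-violation c⁻ lo a S S-violates) (restricted-violation c⁻ lo b T T-violates) ⟩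
        weight lo S′ + weight lo T′
          ≡⟨ weight-modular lo S′ T′ ⟨
        weight lo (S′ ∪ T′) + weight lo (S′ ∩ T′)
          ≤⟨ +-mono-≤ (hakimi⁻ (S′ ∪ T′)) (hakimi⁻ (S′ ∩ T′)) ⟩
        (touching c⁻ (S′ ∪ T′) + [ S′ ∪ T′ ∋a∨b]) + (touching c⁻ (S′ ∩ T′) + [ S′ ∩ T′ ∋a∨b])
          ≡⟨ solve 4 (λ u i m n → (u :+ m) :+ (i :+ n) := (m :+ n) :+ (u :+ i))
                     refl (touching c⁻ (S′ ∪ T′)) (touching c⁻ (S′ ∩ T′)) [ S′ ∪ T′ ∋a∨b] [ S′ ∩ T′ ∋a∨b] ⟩
        ([ S′ ∪ T′ ∋a∨b] + [ S′ ∩ T′ ∋a∨b]) + (touching c⁻ (S′ ∪ T′) + touching c⁻ (S′ ∩ T′))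
          ≤⟨ +-monoʳ-≤ ([ S′ ∪ T′ ∋a∨b] + [ S′ ∩ T′ ∋a∨b]) (touching-submodular c⁻ S′ T′) ⟩
        ([ S′ ∪ T′ ∋a∨b] + [ S′ ∩ T′ ∋a∨b]) + (touching c⁻ S′ + touching c⁻ T′) ∎
        where open ≤-Reasoning

    orientation-step : (∀ lo → HakimiCondition c⁻ lo → Orientation c⁻ lo) → ∀ lo → HakimiCondition c lo → Orientation c lo
    orientation-step orient⁻ lo hakimi
      with hakimi-or-violation c⁻ (λ v → lo v ∸ δ a v) | hakimi-or-violation c⁻ (λ v → lo v ∸ δ b v)
    ... | inj₁ hakimi-a     | _                 = orient-forward lo (orient⁻ _ hakimi-a)
    ... | inj₂ _            | inj₁ hakimi-b     = orient-backward lo (orient⁻ _ hakimi-b)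
    ... | inj₂ (S , S-viol) | inj₂ (T , T-viol) = ⊥-elim (no-double-violation lo S T hakimi S-viol T-viol)

  orientation-of-size : ∀ t c lo → total c ≡ t → HakimiCondition c lo → Orientation c lo
  orientation-of-size zero c lo total≡0 hakimi = (λ _ _ → 0) , (λ _ _ → z≤n) , λ v → ≤-trans (lo≤0 v) z≤n
    where
    lo≤0 : ∀ v → lo v ≤ 0
    lo≤0 v = begin
      lo v              ≤⟨ term≤∑ lo v ⟩
      sum lo            ≡⟨ weight-⊤ lo ⟨
      weight lo ⊤       ≤⟨ hakimi ⊤ ⟩
      touching c ⊤      ≤⟨ touching≤total c ⊤ ⟩
      total c           ≡⟨ total≡0 ⟩
      0                 ∎
      where open ≤-Reasoning
  orientation-of-size (suc t) c lo total≡1+t hakimi with total>0⇒arc c (subst (0 <_) (sym total≡1+t) z<s)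
  ... | a , b , cab>0 = orientation-step (λ lo⁻ → orientation-of-size t c⁻ lo⁻ total-c⁻≡t) lo hakimi
    where
    open RemoveArc c cab>0
    total-c⁻≡t : total c⁻ ≡ t
    total-c⁻≡t = suc-injective (trans (sym total-c⁻) total≡1+t)

  orientation : ∀ c lo → HakimiCondition c lo → Orientation c lo
  orientation c lo = orientation-of-size (total c) c lo refl

-- Balanced orientations and factors of regular bipartite multigraphs

module _ {N : ℕ} where

  arc-degree : Arcs N → Fin N → ℕ
  arc-degree c v = sum λ x → c v x + c x v

  directed : Arcs N → Arcs N → Arcs N
  directed c p u w = p u w + (c w u ∸ p w u)

  Diregular : ℕ → Arcs N → Set
  Diregular r D = (∀ v → sum (D v) ≡ r) × (∀ v → sum (λ u → D u v) ≡ r)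

  ∑-arc-degree : ∀ c → sum (arc-degree c) ≡ total c * 2
  ∑-arc-degree c = begin
    sum (arc-degree c)                                         ≡⟨ sum-cong-≗ {N} (λ v → ∑-distrib-+ {N} (c v) (λ x → c x v)) ⟩
    sum (λ v → sum (c v) + sum (λ x → c x v))                  ≡⟨ ∑-distrib-+ {N} (λ v → sum (c v)) (λ v → sum (λ x → c x v)) ⟩
    total c + sum (λ v → sum (λ x → c x v))                    ≡⟨ cong (total c +_) (∑-comm {N} (λ v x → c x v)) ⟩
    total c + total c                                          ≡⟨ m+m≡m*2 (total c) ⟩
    total c * 2                                                ∎
    where open ≡-Reasoning

  ∑-arc-degree-∈ : ∀ c S → sum (λ v → ⟦ lookup S v ⟧ * arc-degree c v) ≤ touching c S * 2
  ∑-arc-degree-∈ c S = begin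
    sum (λ v → ⟦ lookup S v ⟧ * arc-degree c v)
      ≡⟨ sum-cong-≗ {N} (λ v → trans (*-distribˡ-sum ⟦ lookup S v ⟧ (λ x → c v x + c x v))
                                       (trans (sum-cong-≗ {N} λ x → *-distribˡ-+ ⟦ lookup S v ⟧ (c v x) (c x v))
                                              (∑-distrib-+ {N} _ _))) ⟩
    sum (λ v → sum (λ x → ⟦ lookup S v ⟧ * c v x) + sum (λ x → ⟦ lookup S v ⟧ * c x v))
      ≡⟨ ∑-distrib-+ {N} _ _ ⟩
    sum (λ u → sum λ w → ⟦ lookup S u ⟧ * c u w) + sum (λ v → sum λ x → ⟦ lookup S v ⟧ * c x v)
      ≡⟨ cong (sum (λ u → sum λ w → ⟦ lookup S u ⟧ * c u w) +_) (∑-comm {N} (λ v x → ⟦ lookup S v ⟧ * c x v)) ⟩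
    sum (λ u → sum λ w → ⟦ lookup S u ⟧ * c u w) + sum (λ u → sum λ w → ⟦ lookup S w ⟧ * c u w)
      ≡⟨ trans (sum-cong-≗ {N} (λ u → ∑-distrib-+ {N} _ _)) (∑-distrib-+ {N} _ _) ⟨
    sum (λ u → sum λ w → ⟦ lookup S u ⟧ * c u w + ⟦ lookup S w ⟧ * c u w)
      ≤⟨ ∑-mono-≤ (λ u → ∑-mono-≤ λ w → pointwise (lookup S u) (lookup S w) (c u w)) ⟩
    sum (λ u → sum λ w → c u w * ⟦ lookup S u ∨ lookup S w ⟧ * 2)
      ≡⟨ trans (sum-cong-≗ {N} λ u → sym (*-distribʳ-sum 2 λ w → c u w * ⟦ lookup S u ∨ lookup S w ⟧))
               (sym (*-distribʳ-sum 2 (λ u → sum λ w → c u w * ⟦ lookup S u ∨ lookup S w ⟧))) ⟩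
    touching c S * 2 ∎
    where
    open ≤-Reasoning
    pointwise : ∀ s t x → ⟦ s ⟧ * x + ⟦ t ⟧ * x ≤ x * ⟦ s ∨ t ⟧ * 2
    pointwise s t x = begin
      ⟦ s ⟧ * x + ⟦ t ⟧ * x          ≤⟨ +-mono-≤ (*-monoˡ-≤ x (⟦⟧-mono-∨ˡ s t)) (*-monoˡ-≤ x (⟦⟧-mono-∨ʳ s t)) ⟩
      ⟦ s ∨ t ⟧ * x + ⟦ s ∨ t ⟧ * x  ≡⟨ solve 2 (λ b x → b :* x :+ b :* x := x :* b :* con 2) refl ⟦ s ∨ t ⟧ x ⟩
      x * ⟦ s ∨ t ⟧ * 2              ∎

  ∑-outdegree : ∀ c p → p ⊑ c → sum (outdegree c p) ≡ total c
  ∑-outdegree c p p⊑c = begin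
    sum (λ v → sum (p v) + sum (λ u → c u v ∸ p u v))
      ≡⟨ ∑-distrib-+ {N} _ _ ⟩
    sum (λ v → sum (p v)) + sum (λ v → sum λ u → c u v ∸ p u v)
      ≡⟨ cong (sum (λ v → sum (p v)) +_) (∑-comm {N} (λ v u → c u v ∸ p u v)) ⟩
    sum (λ u → sum (p u)) + sum (λ u → sum λ v → c u v ∸ p u v)
      ≡⟨ trans (sum-cong-≗ {N} (λ u → ∑-distrib-+ {N} (p u) (λ v → c u v ∸ p u v))) (∑-distrib-+ {N} _ _) ⟨
    sum (λ u → sum λ v → p u v + (c u v ∸ p u v))
      ≡⟨ sum-cong-≗ {N} (λ u → sum-cong-≗ {N} λ v → m+[n∸m]≡n (p⊑c u v)) ⟩
    total c ∎
    where open ≡-Reasoning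

  outdegree≡∑directed : ∀ c p v → outdegree c p v ≡ sum (directed c p v)
  outdegree≡∑directed c p v = sym (∑-distrib-+ {N} (p v) (λ w → c w v ∸ p w v))

  directed-+-reverse : ∀ c p → p ⊑ c → ∀ u w → directed c p u w + directed c p w u ≡ c u w + c w u
  directed-+-reverse c p p⊑c u w = begin
    (p u w + (c w u ∸ p w u)) + (p w u + (c u w ∸ p u w))
      ≡⟨ solve 4 (λ a b x y → (a :+ b) :+ (x :+ y) := (a :+ y) :+ (x :+ b)) refl (p u w) (c w u ∸ p w u) (p w u) (c u w ∸ p u w) ⟩
    (p u w + (c u w ∸ p u w)) + (p w u + (c w u ∸ p w u))
      ≡⟨ cong₂ _+_ (m+[n∸m]≡n (p⊑c u w)) (m+[n∸m]≡n (p⊑c w u)) ⟩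
    c u w + c w u ∎
    where open ≡-Reasoning

  even-regular⇒hakimi : ∀ c r → (∀ v → arc-degree c v ≡ r * 2) → HakimiCondition c (λ _ → r)
  even-regular⇒hakimi c r regular S = *-cancelʳ-≤ _ _ 2 (begin
    weight (λ _ → r) S * 2                        ≡⟨ *-distribʳ-sum 2 (λ v → ⟦ lookup S v ⟧ * r) ⟩
    sum (λ v → ⟦ lookup S v ⟧ * r * 2)            ≡⟨ sum-cong-≗ {N} (λ v → trans (*-assoc ⟦ lookup S v ⟧ r 2)
                                                                               (cong (⟦ lookup S v ⟧ *_) (sym (regular v)))) ⟩
    sum (λ v → ⟦ lookup S v ⟧ * arc-degree c v)   ≤⟨ ∑-arc-degree-∈ c S ⟩
    touching c S * 2                              ∎)
    where open ≤-Reasoning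

  even-regular⇒total : ∀ c r → (∀ v → arc-degree c v ≡ r * 2) → total c ≡ N * r
  even-regular⇒total c r regular = *-cancelʳ-≡ _ _ 2 (begin
    total c * 2              ≡⟨ ∑-arc-degree c ⟨
    sum (arc-degree c)       ≡⟨ sum-cong-≗ {N} regular ⟩
    sum {N} (λ _ → r * 2)    ≡⟨ ∑-const N (r * 2) ⟩
    N * (r * 2)              ≡⟨ *-assoc N r 2 ⟨
    N * r * 2                ∎)
    where open ≡-Reasoning

  balanced-orientation : ∀ c r → (∀ v → arc-degree c v ≡ r * 2) →
                         ∃[ D ] Diregular r D × (∀ u w → D u w + D w u ≡ c u w + c w u)
  balanced-orientation c r regular with orientation c (λ _ → r) (even-regular⇒hakimi c r regular)
  ... | p , p⊑c , r≤out = directed c p , (out≡r , in≡r) , directed-+-reverse c p p⊑c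
    where
    out≡r : ∀ v → sum (directed c p v) ≡ r
    out≡r v = begin
      sum (directed c p v)     ≡⟨ outdegree≡∑directed c p v ⟨
      outdegree c p v          ≡⟨ ∑-squeeze r≤out ∑out≤N*r v ⟨
      r                        ∎
      where
      open ≡-Reasoning
      ∑out≤N*r : sum (outdegree c p) ≤ sum {N} (λ _ → r)
      ∑out≤N*r = ≤-reflexive (trans (∑-outdegree c p p⊑c) (trans (even-regular⇒total c r regular) (sym (∑-const N r))))
    in≡r : ∀ v → sum (λ u → directed c p u v) ≡ r
    in≡r v = +-cancelˡ-≡ r _ _ (begin
      r + sum (λ u → directed c p u v)                           ≡⟨ cong (_+ sum (λ u → directed c p u v)) (out≡r v) ⟨
      sum (directed c p v) + sum (λ u → directed c p u v)        ≡⟨ ∑-distrib-+ {N} _ _ ⟨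
      sum (λ x → directed c p v x + directed c p x v)            ≡⟨ sum-cong-≗ {N} (directed-+-reverse c p p⊑c v) ⟩
      arc-degree c v                                             ≡⟨ regular v ⟩
      r * 2                                                      ≡⟨ m+m≡m*2 r ⟨
      r + r                                                      ∎)
      where open ≡-Reasoning

-- D as a bipartite multigraph: the edges go from a left copy of every vertex to a right
-- copy. With demand m at left u, at least m of the r edges at u keep their direction
-- (these form the factor); with demand r ∸ m at right w, at most m of the r edges at w do.
module BipartiteDouble {n : ℕ} (D : Arcs n) where

  left right : Fin n → Fin (n + n)
  left u = u ↑ˡ n
  right w = n ↑ʳ w

  between : Fin n ⊎ Fin n → Fin n ⊎ Fin n → ℕ
  between (inj₁ u) (inj₂ w) = D u w
  between (inj₁ u) (inj₁ w) = 0
  between (inj₂ u) _        = 0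

  double : Arcs (n + n)
  double x y = between (splitAt n x) (splitAt n y)

  double-left-right : ∀ u w → double (left u) (right w) ≡ D u w
  double-left-right u w rewrite splitAt-↑ˡ n u n | splitAt-↑ʳ n n w = refl

  double-to-left : ∀ x u → double x (left u) ≡ 0
  double-to-left x u rewrite splitAt-↑ˡ n u n with splitAt n x
  ... | inj₁ _ = refl
  ... | inj₂ _ = refl

  double-from-right : ∀ w y → double (right w) y ≡ 0
  double-from-right w y rewrite splitAt-↑ʳ n n w = refl

  demand : ℕ → ℕ → Fin (n + n) → ℕ
  demand p q x = on-side (splitAt n x)
    where
    on-side : Fin n ⊎ Fin n → ℕ
    on-side (inj₁ _) = p
    on-side (inj₂ _) = q

  demand-left : ∀ p q u → demand p q (left u) ≡ p
  demand-left p q u rewrite splitAt-↑ˡ n u n = refl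

  demand-right : ∀ p q w → demand p q (right w) ≡ q
  demand-right p q w rewrite splitAt-↑ʳ n n w = refl

  module _ (S : Subset (n + n)) where

    #left #right : ℕ
    #left  = sum λ u → ⟦ lookup S (left u) ⟧
    #right = sum λ w → ⟦ lookup S (right w) ⟧

    crossing : ℕ
    crossing = sum λ u → sum λ w → D u w * ⟦ lookup S (left u) ∨ lookup S (right w) ⟧

    weight-demand : ∀ p q → weight (demand p q) S ≡ p * #left + q * #right
    weight-demand p q = trans (∑-↑ n _) (cong₂ _+_
      (trans (sum-cong-≗ {n} λ u → trans (cong (⟦ lookup S (left u) ⟧ *_) (demand-left p q u)) (*-comm _ p))
             (sym (*-distribˡ-sum p λ u → ⟦ lookup S (left u) ⟧)))
      (trans (sum-cong-≗ {n} λ w → trans (cong (⟦ lookup S (right w) ⟧ *_) (demand-right p q w)) (*-comm _ q))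
             (sym (*-distribˡ-sum q λ w → ⟦ lookup S (right w) ⟧))))

    crossing≤touching : crossing ≤ touching double S
    crossing≤touching = begin
      crossing
        ≡⟨ sum-cong-≗ {n} (λ u → sum-cong-≗ {n} λ w →
             cong (_* ⟦ lookup S (left u) ∨ lookup S (right w) ⟧) (sym (double-left-right u w))) ⟩
      sum (λ u → sum λ w → double (left u) (right w) * ⟦ lookup S (left u) ∨ lookup S (right w) ⟧)
        ≤⟨ ∑-mono-≤ (λ u → ≤-trans (m≤n+m _ _) (≤-reflexive (sym (∑-↑ n (row (left u)))))) ⟩
      sum (λ u → sum (row (left u)))
        ≤⟨ ≤-trans (m≤m+n _ _) (≤-reflexive (sym (∑-↑ n λ x → sum (row x)))) ⟩
      touching double S ∎
      where
      open ≤-Reasoning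
      row : Fin (n + n) → Fin (n + n) → ℕ
      row x y = double x y * ⟦ lookup S x ∨ lookup S y ⟧

    module _ {r : ℕ} (regular : Diregular r D) where

      r*#left≤crossing : r * #left ≤ crossing
      r*#left≤crossing = begin
        r * #left
          ≡⟨ *-distribˡ-sum r (λ u → ⟦ lookup S (left u) ⟧) ⟩
        sum (λ u → r * ⟦ lookup S (left u) ⟧)
          ≡⟨ sum-cong-≗ {n} (λ u → trans (cong (_* ⟦ lookup S (left u) ⟧) (sym (proj₁ regular u)))
                                          (*-distribʳ-sum ⟦ lookup S (left u) ⟧ (D u))) ⟩
        sum (λ u → sum λ w → D u w * ⟦ lookup S (left u) ⟧)
          ≤⟨ ∑-mono-≤ (λ u → ∑-mono-≤ λ w → *-monoʳ-≤ (D u w) (⟦⟧-mono-∨ˡ _ _)) ⟩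
        crossing ∎
        where open ≤-Reasoning

      r*#right≤crossing : r * #right ≤ crossing
      r*#right≤crossing = begin
        r * #right
          ≡⟨ *-distribˡ-sum r (λ w → ⟦ lookup S (right w) ⟧) ⟩
        sum (λ w → r * ⟦ lookup S (right w) ⟧)
          ≡⟨ sum-cong-≗ {n} (λ w → trans (cong (_* ⟦ lookup S (right w) ⟧) (sym (proj₂ regular w)))
                                          (*-distribʳ-sum ⟦ lookup S (right w) ⟧ (λ u → D u w))) ⟩
        sum (λ w → sum λ u → D u w * ⟦ lookup S (right w) ⟧)
          ≡⟨ ∑-comm {n} (λ w u → D u w * ⟦ lookup S (right w) ⟧) ⟩
        sum (λ u → sum λ w → D u w * ⟦ lookup S (right w) ⟧)
          ≤⟨ ∑-mono-≤ (λ u → ∑-mono-≤ λ w → *-monoʳ-≤ (D u w) (⟦⟧-mono-∨ʳ (lookup S (left u)) _)) ⟩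
        crossing ∎
        where open ≤-Reasoning

  double-hakimi : ∀ {r m} → Diregular r D → m ≤ r → HakimiCondition double (demand m (r ∸ m))
  double-hakimi {r} {m} regular m≤r S = begin
    weight (demand m (r ∸ m)) S      ≡⟨ weight-demand S m (r ∸ m) ⟩
    m * #left S + (r ∸ m) * #right S ≤⟨ ≤-convex m≤r (r*#left≤crossing S regular) (r*#right≤crossing S regular) ⟩
    crossing S                       ≤⟨ crossing≤touching S ⟩
    touching double S                ∎
    where open ≤-Reasoning

bipartite-factor : ∀ {n} (D : Arcs n) {r m} → Diregular r D → m ≤ r → ∃[ F ] F ⊑ D × Diregular m F
bipartite-factor {n} D {r} {m} regular@(_ , in≡r) m≤r
  with orientation (BipartiteDouble.double D) _ (BipartiteDouble.double-hakimi D regular m≤r)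
... | p , p⊑double , demand≤out = F , F⊑D , row≡m , column≡m
  where
  open BipartiteDouble D

  F : Arcs n
  F u w = p (left u) (right w)

  F⊑D : F ⊑ D
  F⊑D u w = subst (F u w ≤_) (double-left-right u w) (p⊑double (left u) (right w))

  p≡0 : ∀ x y → double x y ≡ 0 → p x y ≡ 0
  p≡0 x y double≡0 = n≤0⇒n≡0 (subst (p x y ≤_) double≡0 (p⊑double x y))

  outdegree-left : ∀ u → outdegree double p (left u) ≡ sum (F u)
  outdegree-left u = begin
    sum (p (left u)) + sum (λ x → double x (left u) ∸ p x (left u))
      ≡⟨ cong₂ _+_ (∑-↑ n (p (left u)))
                   (∑-zero λ x → trans (cong (_∸ p x (left u)) (double-to-left x u)) (0∸n≡0 (p x (left u)))) ⟩
    (sum (λ w → p (left u) (left w)) + sum (F u)) + 0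
      ≡⟨ cong (λ s → (s + sum (F u)) + 0) (∑-zero λ w → p≡0 (left u) (left w) (double-to-left (left u) w)) ⟩
    sum (F u) + 0
      ≡⟨ +-identityʳ _ ⟩
    sum (F u) ∎
    where open ≡-Reasoning

  outdegree-right : ∀ w → outdegree double p (right w) ≡ r ∸ sum (λ u → F u w)
  outdegree-right w = begin
    sum (p (right w)) + sum (λ x → double x (right w) ∸ p x (right w))
      ≡⟨ cong₂ _+_ (∑-zero λ y → p≡0 (right w) y (double-from-right w y)) (∑-↑ n _) ⟩
    sum (λ u → double (left u) (right w) ∸ F u w) + sum (λ u → double (right u) (right w) ∸ p (right u) (right w))
      ≡⟨ cong₂ _+_ (sum-cong-≗ {n} λ u → cong (_∸ F u w) (double-left-right u w))
                   (∑-zero λ u → trans (cong (_∸ p (right u) (right w)) (double-from-right u (right w)))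
                                         (0∸n≡0 (p (right u) (right w)))) ⟩
    sum (λ u → D u w ∸ F u w) + 0
      ≡⟨ +-identityʳ _ ⟩
    sum (λ u → D u w ∸ F u w)
      ≡⟨ ∑-∸ (λ u → D u w) (λ u → F u w) (λ u → F⊑D u w) ⟩
    sum (λ u → D u w) ∸ sum (λ u → F u w)
      ≡⟨ cong (_∸ sum (λ u → F u w)) (in≡r w) ⟩
    r ∸ sum (λ u → F u w) ∎
    where open ≡-Reasoning

  m≤row : ∀ u → m ≤ sum (F u)
  m≤row u = subst₂ _≤_ (demand-left m (r ∸ m) u) (outdegree-left u) (demand≤out (left u))

  column≤m : ∀ w → sum (λ u → F u w) ≤ m
  column≤m w = ∸-cancelʳ-≤ column≤r (subst₂ _≤_ (demand-right m (r ∸ m) w) (outdegree-right w) (demand≤out (right w)))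
    where
    column≤r : sum (λ u → F u w) ≤ r
    column≤r = subst (sum (λ u → F u w) ≤_) (in≡r w) (∑-mono-≤ λ u → F⊑D u w)

  row≡m : ∀ u → sum (F u) ≡ m
  row≡m u = sym (∑-squeeze m≤row (≤-trans (≤-reflexive (∑-comm {n} F)) (∑-mono-≤ column≤m)) u)

  column≡m : ∀ w → sum (λ u → F u w) ≡ m
  column≡m = ∑-squeeze column≤m (≤-trans (∑-mono-≤ m≤row) (≤-reflexive (∑-comm {n} F)))

length-filterᵇ-tabulate : ∀ {A : Set} {n} (P : A → Bool) (f : Fin n → A) →
                          List.length (List.filterᵇ P (List.tabulate f)) ≡ sum (λ i → ⟦ P (f i) ⟧)
length-filterᵇ-tabulate {n = zero}  P f = refl
length-filterᵇ-tabulate {n = suc n} P f with P (f zero)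
... | true  = cong suc (length-filterᵇ-tabulate P (f ∘ suc))
... | false = length-filterᵇ-tabulate P (f ∘ suc)

degree≡∑adj : ∀ {n} (G : Graph n) v → degree G v ≡ sum (λ x → ⟦ adj G v x ⟧)
degree≡∑adj G v = length-filterᵇ-tabulate (adj G v) (λ x → x)

below : ∀ {n} → Graph n → Arcs n
below G u w = ⟦ does (u Fin.<? w) ∧ adj G u w ⟧

below-+-reverse : ∀ {n} (G : Graph n) u w → below G u w + below G w u ≡ ⟦ adj G u w ⟧
below-+-reverse G u w rewrite Graph.sym G w u with Fin.<-cmp u w
... | tri< u<w _ w≮u rewrite dec-true (u Fin.<? w) u<w | dec-false (w Fin.<? u) w≮u = +-identityʳ _
... | tri> u≮w _ w<u rewrite dec-false (u Fin.<? w) u≮w | dec-true (w Fin.<? u) w<u = refl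
... | tri≈ _ refl _  rewrite irrefl G u | ∧-zeroʳ (does (u Fin.<? u)) = refl

arc-degree-below : ∀ {n} (G : Graph n) v → arc-degree (below G) v ≡ degree G v
arc-degree-below G v = trans (sum-cong-≗ (below-+-reverse G v)) (sym (degree≡∑adj G v))

regular⇒2∣n*d : ∀ {n d} (G : Graph n) → Regular d G → 2 ∣ n * d
regular⇒2∣n*d {n} {d} G regular = divides (total (below G)) (begin
  n * d                            ≡⟨ ∑-const n d ⟨
  sum {n} (λ _ → d)                ≡⟨ sum-cong-≗ {n} (λ v → trans (sym (regular v)) (sym (arc-degree-below G v))) ⟩
  sum (arc-degree (below G))       ≡⟨ ∑-arc-degree (below G) ⟩
  total (below G) * 2              ∎)
  where open ≡-Reasoning

edgeless : ∀ {n} → Graph n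
edgeless = record { adj = λ _ _ → false ; sym = λ _ _ → refl ; irrefl = λ _ → refl }

degree-edgeless : ∀ {n} (v : Fin n) → degree edgeless v ≡ 0
degree-edgeless {n} v = trans (degree≡∑adj edgeless v) (trans (∑-const n 0) (*-zeroʳ n))

opposite≢ : ∀ {n} → 2 ∣ n → (v : Fin n) → v ≢ opposite v
opposite≢ {n} 2∣n v v≡opposite = ¬2∣1 (∣m+n∣m⇒∣n 2∣t+t+1 (divides t (m+m≡m*2 t)))
  where
  t = toℕ v
  t≡n∸[1+t] : t ≡ n ∸ suc t
  t≡n∸[1+t] = trans (cong toℕ v≡opposite) (opposite-prop v)
  2∣t+t+1 : 2 ∣ t + t + 1
  2∣t+t+1 = subst (2 ∣_) (begin
    n                ≡⟨ m∸n+n≡m (toℕ<n v) ⟨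
    n ∸ suc t + suc t ≡⟨ cong (_+ suc t) t≡n∸[1+t] ⟨
    t + suc t        ≡⟨ +-suc t t ⟩
    suc (t + t)      ≡⟨ +-comm 1 (t + t) ⟩
    t + t + 1        ∎) 2∣n
    where open ≡-Reasoning

opposite-matching : ∀ {n} → 2 ∣ n → Graph n
opposite-matching 2∣n = record
  { adj    = λ u w → does (w ≟ opposite u)
  ; sym    = symmetric
  ; irrefl = λ v → dec-false (v ≟ opposite v) (opposite≢ 2∣n v)
  }
  where
  symmetric : ∀ u w → does (w ≟ opposite u) ≡ does (u ≟ opposite w)
  symmetric u w with w ≟ opposite u | u ≟ opposite w
  ... | yes _     | yes _     = refl
  ... | no  _     | no  _     = refl
  ... | yes refl  | no  u≢    = ⊥-elim (u≢ (sym (opposite-involutive u)))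
  ... | no  w≢    | yes refl  = ⊥-elim (w≢ (sym (opposite-involutive w)))

degree-opposite-matching : ∀ {n} (2∣n : 2 ∣ n) (v : Fin n) → degree (opposite-matching 2∣n) v ≡ 1
degree-opposite-matching {n} 2∣n v = begin
  degree (opposite-matching 2∣n) v     ≡⟨ degree≡∑adj (opposite-matching 2∣n) v ⟩
  sum (δ (opposite v))                 ≡⟨ sum-cong-≗ {n} (λ x → *-identityʳ (δ (opposite v) x)) ⟨
  sum (λ x → δ (opposite v) x * 1)     ≡⟨ ∑-δ* (opposite v) (λ _ → 1) ⟩
  1                                    ∎
  where open ≡-Reasoning

restrict : ∀ {n} → Graph n → Arcs n → Graph n
restrict G F = record
  { adj    = λ x y → adj G x y ∧ (0 <ᵇ F x y + F y x)
  ; sym    = λ x y → cong₂ _∧_ (Graph.sym G x y) (cong (0 <ᵇ_) (+-comm (F x y) (F y x)))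
  ; irrefl = λ v → cong (_∧ (0 <ᵇ F v v + F v v)) (irrefl G v)
  }

restrict-spanning : ∀ {n} (G : Graph n) F → SpanningSubgraph (restrict G F) G
restrict-spanning G F u v with adj G u v
... | true  = λ _ → tt
... | false = λ ()

⟦∧0<ᵇ⟧-bounds : ∀ b f e → f ≤ ⟦ b ⟧ + e → ⟦ b ∧ (0 <ᵇ f) ⟧ ≤ f × f ≤ ⟦ b ∧ (0 <ᵇ f) ⟧ + e
⟦∧0<ᵇ⟧-bounds false f       e f≤ = z≤n , f≤
⟦∧0<ᵇ⟧-bounds true  zero    e f≤ = z≤n , z≤n
⟦∧0<ᵇ⟧-bounds true  (suc f) e f≤ = s≤s z≤n , f≤

near-regular-factor : ∀ {n r m} (G M : Graph n) → (∀ v → degree M v ≤ 1) →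
  (∀ v → degree G v + degree M v ≡ r * 2) → m ≤ r →
  Σ (Graph n) λ H → SpanningSubgraph H G × ((v : Fin n) → degree H v ≡ m * 2 ⊎ suc (degree H v) ≡ m * 2)
near-regular-factor {n} {r} {m} G M degree-M≤1 regular m≤r =
  restrict G F , restrict-spanning G F , λ v → ≤-≤-suc⇒≡⊎suc≡ (upper v) (lower v)
  where
  c : Arcs n
  c u w = below G u w + below M u w

  c-+-reverse : ∀ u w → c u w + c w u ≡ ⟦ adj G u w ⟧ + ⟦ adj M u w ⟧
  c-+-reverse u w = trans (+-interchange (below G u w) (below M u w) (below G w u) (below M w u))
                          (cong₂ _+_ (below-+-reverse G u w) (below-+-reverse M u w))

  arc-degree-c : ∀ v → arc-degree c v ≡ r * 2
  arc-degree-c v = begin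
    arc-degree c v                                          ≡⟨ sum-cong-≗ {n} (c-+-reverse v) ⟩
    sum (λ x → ⟦ adj G v x ⟧ + ⟦ adj M v x ⟧)               ≡⟨ ∑-distrib-+ {n} _ _ ⟩
    sum (λ x → ⟦ adj G v x ⟧) + sum (λ x → ⟦ adj M v x ⟧)   ≡⟨ cong₂ _+_ (degree≡∑adj G v) (degree≡∑adj M v) ⟨
    degree G v + degree M v                                 ≡⟨ regular v ⟩
    r * 2                                                   ∎
    where open ≡-Reasoning

  balanced : ∃[ D ] Diregular r D × (∀ u w → D u w + D w u ≡ c u w + c w u)
  balanced = balanced-orientation c r arc-degree-c

  D : Arcs n
  D = proj₁ balanced

  factor : ∃[ F ] F ⊑ D × Diregular m F
  factor = bipartite-factor D (proj₁ (proj₂ balanced)) m≤r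

  F : Arcs n
  F = proj₁ factor

  H : Graph n
  H = restrict G F

  module _ (v : Fin n) where

    f : Fin n → ℕ
    f x = F v x + F x v

    bounds : ∀ x → ⟦ adj H v x ⟧ ≤ f x × f x ≤ ⟦ adj H v x ⟧ + ⟦ adj M v x ⟧
    bounds x = ⟦∧0<ᵇ⟧-bounds (adj G v x) (f x) ⟦ adj M v x ⟧ (begin
      F v x + F x v                     ≤⟨ +-mono-≤ (proj₁ (proj₂ factor) v x) (proj₁ (proj₂ factor) x v) ⟩
      D v x + D x v                     ≡⟨ proj₂ (proj₂ balanced) v x ⟩
      c v x + c x v                     ≡⟨ c-+-reverse v x ⟩
      ⟦ adj G v x ⟧ + ⟦ adj M v x ⟧     ∎)
      where open ≤-Reasoning

    ∑f : sum f ≡ m * 2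
    ∑f = trans (∑-distrib-+ {n} (F v) (λ x → F x v))
               (trans (cong₂ _+_ (proj₁ (proj₂ (proj₂ factor)) v) (proj₂ (proj₂ (proj₂ factor)) v)) (m+m≡m*2 m))

    upper : degree H v ≤ m * 2
    upper = begin
      degree H v                  ≡⟨ degree≡∑adj H v ⟩
      sum (λ x → ⟦ adj H v x ⟧)   ≤⟨ ∑-mono-≤ (proj₁ ∘ bounds) ⟩
      sum f                       ≡⟨ ∑f ⟩
      m * 2                       ∎
      where open ≤-Reasoning

    lower : m * 2 ≤ suc (degree H v)
    lower = begin
      m * 2                                                   ≡⟨ ∑f ⟨
      sum f                                                   ≤⟨ ∑-mono-≤ (proj₂ ∘ bounds) ⟩
      sum (λ x → ⟦ adj H v x ⟧ + ⟦ adj M v x ⟧)               ≡⟨ ∑-distrib-+ {n} _ _ ⟩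
      sum (λ x → ⟦ adj H v x ⟧) + sum (λ x → ⟦ adj M v x ⟧)   ≡⟨ cong₂ _+_ (degree≡∑adj H v) (degree≡∑adj M v) ⟨
      degree H v + degree M v                                 ≤⟨ +-monoʳ-≤ (degree H v) (degree-M≤1 v) ⟩
      degree H v + 1                                          ≡⟨ +-comm (degree H v) 1 ⟩
      suc (degree H v)                                        ∎
      where open ≤-Reasoning

odd-regular⇒even-order : ∀ {n d} (G : Graph n) → Regular d G → 2 ∣ suc d → 2 ∣ n
odd-regular⇒even-order {n} {d} G regular 2∣1+d with euclidsLemma n d prime[2] (regular⇒2∣n*d G regular)
... | inj₁ 2∣n = 2∣n
... | inj₂ 2∣d = ⊥-elim (¬2∣1 (∣m+n∣m⇒∣n (subst (2 ∣_) (+-comm 1 d) 2∣1+d) 2∣d))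

lemma2p3 : (k d : ℕ) → 2 ∣ k → k ≤ d → (n : ℕ) → (G : Graph n) → Regular d G →
    Σ (Graph n) (λ H → SpanningSubgraph H G × ((v : Fin n) → degree H v ≡ k ⊎ suc (degree H v) ≡ k))
lemma2p3 .(q * 2) d (divides q refl) q*2≤d n G regular with even-or-odd d
... | inj₁ (divides r d≡r*2) =
  near-regular-factor G edgeless (λ v → ≤-trans (≤-reflexive (degree-edgeless v)) z≤n)
    (λ v → trans (cong₂ _+_ (regular v) (degree-edgeless v)) (trans (+-identityʳ d) d≡r*2))
    (*-cancelʳ-≤ q r 2 (subst (q * 2 ≤_) d≡r*2 q*2≤d))
... | inj₂ 2∣1+d@(divides r 1+d≡r*2) =
  near-regular-factor G (opposite-matching 2∣n) (λ v → ≤-reflexive (degree-opposite-matching 2∣n v))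
    (λ v → trans (cong₂ _+_ (regular v) (degree-opposite-matching 2∣n v)) (trans (+-comm d 1) 1+d≡r*2))
    (*-cancelʳ-≤ q r 2 (≤-trans q*2≤d (subst (d ≤_) 1+d≡r*2 (n≤1+n d))))
  where
  2∣n : 2 ∣ n
  2∣n = odd-regular⇒even-order G regular 2∣1+d
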